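{- For a positive integer $z$, let $\mathcal F^b_{ps}(z)$ be the set of pseudo-split graphs that are minimal $z$-bicolorable obstructions. Then $\mathcal F^b_{ps}(1)=\{K_2,\overline{K_2}\}$, $\mathcal F^b_{ps}(2)=\{K_3,C_5,\overline{K_3}\}$, and for every integer $z\ge 3$, $\mathcal F^b_{ps}(z)=\{K_{z+1},\ C_5\oplus K_{z-2},\ \overline{K_{z+1}},\ C_5+\overline{K_{z-2}}\}$.
   Context: All graphs are finite and simple; $G+H$ denotes disjoint union, $G\oplus H$ join, $\overline G$ complement. A graph $G$ is pseudo-split if $V_G$ has a partition $(C,S,I)$ with $C$ a clique, $I$ independent, $S=\varnothing$ or $G[S]\cong C_5$, $C$ completely adjacent to $S$, and no edges between $I$ and $S$. A $(k,\ell)$-coloring of $G$ is a partition of $V_G$ into $k$ independent sets and $\ell$ cliques; $G$ is $z$-bicolorable if it is $(k,\ell)$-colorable for all nonnegative integers $k,\ell$ with $k+\ell=z$. A minimal $z$-bicolorable obstruction is a graph that is not $z$-bicolorable but every vertex-deleted subgraph of which is. -}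

module Defs where

open import Data.Nat using (ℕ; zero; suc; _+_; _%_)
open import Data.Bool using (Bool; true; false; not; _∨_; _∧_)
open import Data.Fin using (Fin; toℕ; punchIn; splitAt)
open import Data.Fin.Properties using () renaming (_≟_ to _≟ᶠ_)
open import Data.Nat.Properties using () renaming (_≟_ to _≟ⁿ_)
open import Data.Sum using (_⊎_) renaming (inj₁ to left; inj₂ to right)
open import Data.Product using (Σ; ∃; _×_; _,_)
open import Data.Unit using (⊤)
open import Relation.Nullary using (¬_)
open import Relation.Nullary.Decidable using (⌊_⌋)
open import Relation.Binary.PropositionalEquality using (_≡_; _≢_)
open import Function.Bundles using (_↔_; Inverse)

record Graph (n : ℕ) : Set where
  constructor mkGraph
  field
    adj : Fin n → Fin n → Bool
open Graph public

IsSimple : ∀ {n} → Graph n → Set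
IsSimple G = (∀ u v → adj G u v ≡ adj G v u) × (∀ u → adj G u u ≡ false)

_≅_ : ∀ {n m} → Graph n → Graph m → Set
_≅_ {n} {m} G H = Σ (Fin n ↔ Fin m) λ f →
  ∀ u v → adj H (Inverse.to f u) (Inverse.to f v) ≡ adj G u v

infix 4 _≅_

K : (n : ℕ) → Graph n
K n = mkGraph λ u v → not ⌊ u ≟ᶠ v ⌋

complement : ∀ {n} → Graph n → Graph n
complement G = mkGraph λ u v → not ⌊ u ≟ᶠ v ⌋ ∧ not (adj G u v)

C5 : Graph 5
C5 = mkGraph λ i j →
  ⌊ (toℕ i + 1) % 5 ≟ⁿ toℕ j ⌋ ∨ ⌊ (toℕ j + 1) % 5 ≟ⁿ toℕ i ⌋

_⊕U_ : ∀ {m n} → Graph m → Graph n → Graph (m + n)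
_⊕U_ {m} {n} G H = mkGraph λ u v → go (splitAt m u) (splitAt m v)
  where
  go : Fin m ⊎ Fin n → Fin m ⊎ Fin n → Bool
  go (left a) (left b) = adj G a b
  go (right a) (right b) = adj H a b
  go _ _ = false

_⊕J_ : ∀ {m n} → Graph m → Graph n → Graph (m + n)
_⊕J_ {m} {n} G H = mkGraph λ u v → go (splitAt m u) (splitAt m v)
  where
  go : Fin m ⊎ Fin n → Fin m ⊎ Fin n → Bool
  go (left a) (left b) = adj G a b
  go (right a) (right b) = adj H a b
  go _ _ = true

delete : ∀ {n} → Graph (suc n) → Fin (suc n) → Graph n
delete G v = mkGraph λ a b → adj G (punchIn v a) (punchIn v b)

-- (k,ℓ)-coloring: each vertex gets one of k "independent" colours or one of
-- ℓ "clique" colours; the colour classes form the partition (empty parts allowed).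
record Coloring {n} (k ℓ : ℕ) (G : Graph n) : Set where
  field
    col   : Fin n → Fin k ⊎ Fin ℓ
    indep : ∀ u v i → u ≢ v → col u ≡ left i → col v ≡ left i → adj G u v ≡ false
    cliq  : ∀ u v j → u ≢ v → col u ≡ right j → col v ≡ right j → adj G u v ≡ true

Bicolorable : ℕ → ∀ {n} → Graph n → Set
Bicolorable z G = ∀ k ℓ → k + ℓ ≡ z → Coloring k ℓ G

AllVertexDeletedBicolorable : ℕ → ∀ {n} → Graph n → Set
AllVertexDeletedBicolorable z {zero} G = ⊤
AllVertexDeletedBicolorable z {suc n} G = ∀ v → Bicolorable z (delete G v)

MinimalObstruction : ℕ → ∀ {n} → Graph n → Set
MinimalObstruction z G = ¬ Bicolorable z G × AllVertexDeletedBicolorable z G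

data Part : Set where
  pC pS pI : Part

-- G[S] ≅ C5 where S = {v | p v ≡ pS}: a bijection Fin 5 → S preserving adjacency
InducesC5 : ∀ {n} → Graph n → (Fin n → Part) → Set
InducesC5 {n} G p = Σ (Fin 5 → Fin n) λ f →
  (∀ i j → f i ≡ f j → i ≡ j) ×
  (∀ i → p (f i) ≡ pS) ×
  (∀ v → p v ≡ pS → ∃ λ i → f i ≡ v) ×
  (∀ i j → adj G (f i) (f j) ≡ adj C5 i j)

PseudoSplit : ∀ {n} → Graph n → Set
PseudoSplit {n} G = Σ (Fin n → Part) λ p →
  (∀ u v → u ≢ v → p u ≡ pC → p v ≡ pC → adj G u v ≡ true) ×
  (∀ u v → p u ≡ pI → p v ≡ pI → adj G u v ≡ false) ×
  ((∀ v → ¬ (p v ≡ pS)) ⊎ InducesC5 G p) ×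
  (∀ u v → p u ≡ pC → p v ≡ pS → adj G u v ≡ true) ×
  (∀ u v → p u ≡ pI → p v ≡ pS → adj G u v ≡ false)

InFps : ℕ → ∀ {n} → Graph n → Set
InFps z G = PseudoSplit G × MinimalObstruction z G

-- Complementation exchanges (k,ℓ)-colorings with (ℓ,k)-colorings and preserves pseudo-splitness
-- and minimal obstructions, and a minimal obstruction is isomorphic to each of its non-bicolorable
-- induced subgraphs. Let G = (C,S,I) be pseudo-split. If S is empty, G is split and hence perfect:
-- it contains K ω and is ω-colorable, with ω = |C| or |C| + 1; it also has every mixed coloring.
-- Otherwise G contains C5 ⊕ K |C|, is (|C| + 3)-colorable, and has the mixed (k,ℓ)-colorings with
-- k + ℓ ≥ 3. So a pseudo-split minimal z-bicolorable obstruction, or its complement, contains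
-- K (z + 1) or C5 ⊕ K (z - 2) (just C5 when z = 2), and is therefore one of these graphs or the
-- complement of one. All of them are minimal obstructions; since C5 is self-complementary, the
-- complement of C5 ⊕ K m is C5 + complement (K m).

module Submission where

open import Defs
open import Data.Nat using (ℕ; zero; suc; _+_; _∸_; _≤_; z≤n; s≤s)
open import Data.Nat.DivMod using (_mod_)
open import Data.Nat.Properties using (+-comm; +-identityʳ; ≤-refl; ≤-reflexive; 1+n≰n; _≤?_; ≰⇒>; ≤-pred; +-monoʳ-≤)
open import Data.Bool using (Bool; true; false; not)
open import Data.Bool.Properties using (not-involutive; ¬-not) renaming (_≟_ to _≟ᵇ_)
open import Data.Vec using ([]; _∷_; lookup)
open import Data.Fin using (Fin; zero; suc; #_; toℕ; inject≤; splitAt; _↑ˡ_; _↑ʳ_; join; punchIn; punchOut)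
open import Data.Fin.Properties
  using ( inject≤-injective; punchIn-injective; punchInᵢ≢i; punchOut-injective; punchIn-punchOut; any?; all?
        ; ¬∀⟶∃¬; suc-injective; injective⇒≤; splitAt-↑ˡ; splitAt-join; join-splitAt; ↑ˡ-injective; ↑ʳ-injective )
  renaming (_≟_ to _≟ᶠ_)
open import Data.Sum using (_⊎_; inj₁; inj₂; [_,_]′; swap; fromInj₁) renaming (map to ⊎-map; map₂ to ⊎-map₂)
open import Data.Sum.Properties using (inj₁-injective; inj₂-injective; swap-involutive; ≡-dec)
open import Data.Unit using (tt)
open import Data.Product using (Σ; ∃; _×_; _,_; proj₁; proj₂)
open import Function using (_∘_; const; id)
open import Function.Definitions using (Injective)
open import Function.Bundles using (Inverse; mk↔ₛ′; _⇔_; mk⇔)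
open import Function.Properties.Inverse using (↔-refl; ↔-trans)
open import Relation.Nullary using (¬_; Dec; yes; no; contradiction; ¬?)
open import Relation.Nullary.Decidable using (True; toWitness; from-yes; _→-dec_; _×-dec_)
open import Relation.Binary.PropositionalEquality using (_≡_; _≢_; refl; sym; trans; cong; cong₂; subst; module ≡-Reasoning)
open import Data.List using (List; filter; allFin; length) renaming (lookup to lookupₗ)
open import Data.List.Membership.Propositional.Properties using (∈-lookup; ∈-allFin; ∈-filter⁺)
open import Data.List.Relation.Unary.All as All using ()
open import Data.List.Relation.Unary.All.Properties using (all-filter)
open import Data.List.Relation.Unary.Any as Any using ()
open import Data.List.Relation.Unary.Any.Properties using (lookup-index)
open import Data.List.Relation.Unary.AllPairs using (_∷_)
open import Data.List.Relation.Unary.Unique.Propositional using (Unique)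
open import Data.List.Relation.Unary.Unique.Propositional.Properties using (allFin⁺; filter⁺)
open import Relation.Unary using (Decidable)
open import Relation.Binary.Definitions using (DecidableEquality)

open ≡-Reasoning

-- Colorings

isCliqueColor : ∀ {A B : Set} → A ⊎ B → Bool
isCliqueColor = [ const false , const true ]′

Proper : ∀ {n} {A B : Set} → Graph n → (Fin n → A ⊎ B) → Set
Proper G c = ∀ u v → u ≢ v → c u ≡ c v → adj G u v ≡ isCliqueColor (c u)

module _ {n} {G : Graph n} where

  proper⇒coloring : ∀ {k ℓ} {c : Fin n → Fin k ⊎ Fin ℓ} → Proper G c → Coloring k ℓ G
  proper⇒coloring {c = c} ok = record
    { col   = c
    ; indep = λ u v i u≢v cu cv → trans (ok u v u≢v (trans cu (sym cv))) (cong isCliqueColor cu)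
    ; cliq  = λ u v j u≢v cu cv → trans (ok u v u≢v (trans cu (sym cv))) (cong isCliqueColor cu)
    }

  coloring⇒proper : ∀ {k ℓ} (c : Coloring k ℓ G) → Proper G (Coloring.col c)
  coloring⇒proper c u v u≢v same with Coloring.col c u in cu
  ... | inj₁ i = Coloring.indep c u v i u≢v cu (sym same)
  ... | inj₂ j = Coloring.cliq c u v j u≢v cu (sym same)

  proper-map : ∀ {A B A′ B′ : Set} {f : A → A′} {g : B → B′} {c : Fin n → A ⊎ B} →
    Injective _≡_ _≡_ f → Injective _≡_ _≡_ g → Proper G c → Proper G (⊎-map f g ∘ c)
  proper-map {c = c} f-inj g-inj ok u v u≢v same with c u | c v | ok u v u≢v
  ... | inj₁ a | inj₁ a′ | ok′ = ok′ (cong inj₁ (f-inj (inj₁-injective same)))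
  ... | inj₂ b | inj₂ b′ | ok′ = ok′ (cong inj₂ (g-inj (inj₂-injective same)))

coloring-weaken : ∀ {n k ℓ k′ ℓ′} {G : Graph n} → k ≤ k′ → ℓ ≤ ℓ′ → Coloring k ℓ G → Coloring k′ ℓ′ G
coloring-weaken k≤k′ ℓ≤ℓ′ c = proper⇒coloring
  (proper-map (inject≤-injective k≤k′ k≤k′ _ _) (inject≤-injective ℓ≤ℓ′ ℓ≤ℓ′ _ _) (coloring⇒proper c))

bicolorable : ∀ {z n} {G : Graph n} → Coloring z 0 G → Coloring 0 z G →
  (∀ k ℓ → suc k + suc ℓ ≡ z → Coloring (suc k) (suc ℓ) G) → Bicolorable z G
bicolorable         independent cliques mixed zero    ℓ       refl = cliques
bicolorable {G = G} independent cliques mixed (suc k) zero    eq   =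
  subst (λ k → Coloring k 0 G) (sym (trans (sym (+-identityʳ (suc k))) eq)) independent
bicolorable         independent cliques mixed (suc k) (suc ℓ) eq   = mixed k ℓ eq

discreteColoring : ∀ {n} (G : Graph n) → Coloring n 0 G
discreteColoring G = proper⇒coloring λ u v u≢v same → contradiction (inj₁-injective same) u≢v

independentColor : ∀ {k} → Fin k ⊎ Fin 0 → Fin k
independentColor = fromInj₁ (λ ())

independentColor-proper : ∀ {n k} {G : Graph n} (c : Coloring k 0 G) {u v} → u ≢ v →
  independentColor (Coloring.col c u) ≡ independentColor (Coloring.col c v) → adj G u v ≡ false
independentColor-proper c {u} {v} u≢v same with Coloring.col c u | Coloring.col c v | coloring⇒proper c u v u≢v
... | inj₁ i | inj₁ j | ok = ok (cong inj₁ same)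

independentColor-adjacent : ∀ {n k} {G : Graph n} (c : Coloring k 0 G) {u v} → u ≢ v → adj G u v ≡ true →
  independentColor (Coloring.col c u) ≢ independentColor (Coloring.col c v)
independentColor-adjacent c u≢v uv same = contradiction (trans (sym uv) (independentColor-proper c u≢v same)) λ ()

proper? : ∀ {n k ℓ} (G : Graph n) (c : Fin n → Fin k ⊎ Fin ℓ) → Dec (Proper G c)
proper? G c = all? λ u → all? λ v → ¬? (u ≟ᶠ v) →-dec
  (≡-dec _≟ᶠ_ _≟ᶠ_ (c u) (c v) →-dec (adj G u v ≟ᵇ isCliqueColor (c u)))

adjacent⇒distinct : ∀ {n} {G : Graph n} → (∀ u → adj G u u ≡ false) → ∀ {u v} → adj G u v ≡ true → u ≢ v
adjacent⇒distinct loopless uv refl = contradiction (trans (sym uv) (loopless _)) λ ()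

-- Injections and enumerations of finite sets

splitAt-injective : ∀ m {n} {x y : Fin (m + n)} → splitAt m x ≡ splitAt m y → x ≡ y
splitAt-injective m {n} {x} {y} eq = trans (sym (join-splitAt m n x)) (trans (cong (join m n) eq) (join-splitAt m n y))

join-injective : ∀ m n {s t : Fin m ⊎ Fin n} → join m n s ≡ join m n t → s ≡ t
join-injective m n {s} {t} eq = trans (sym (splitAt-join m n s)) (trans (cong (splitAt m) eq) (splitAt-join m n t))

disjoint-injections⇒≤ : ∀ {a b k} {f : Fin a → Fin k} {g : Fin b → Fin k} →
  Injective _≡_ _≡_ f → Injective _≡_ _≡_ g → (∀ i j → f i ≢ g j) → a + b ≤ k
disjoint-injections⇒≤ {a} {b} {f = f} {g} f-injective g-injective disjoint =
  injective⇒≤ {f = [ f , g ]′ ∘ splitAt a} (splitAt-injective a ∘ injective _ _)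
  where
  injective : ∀ s t → [ f , g ]′ s ≡ [ f , g ]′ t → s ≡ t
  injective (inj₁ i) (inj₁ i′) eq = cong inj₁ (f-injective eq)
  injective (inj₂ j) (inj₂ j′) eq = cong inj₂ (g-injective eq)
  injective (inj₁ i) (inj₂ j)  eq = contradiction eq (disjoint i j)
  injective (inj₂ j) (inj₁ i)  eq = contradiction (sym eq) (disjoint i j)

lookup-injective : ∀ {A : Set} {xs : List A} → Unique xs → ∀ {i j} → lookupₗ xs i ≡ lookupₗ xs j → i ≡ j
lookup-injective (_  ∷ _) {zero}  {zero}  _  = refl
lookup-injective (x∉ ∷ _) {zero}  {suc j} eq = contradiction eq (All.lookup x∉ (∈-lookup j))
lookup-injective (x∉ ∷ _) {suc i} {zero}  eq = contradiction (sym eq) (All.lookup x∉ (∈-lookup i))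
lookup-injective (_  ∷ u) {suc i} {suc j} eq = cong suc (lookup-injective u eq)

record Enumeration {n} (P : Fin n → Set) : Set where
  field
    size              : ℕ
    element           : Fin size → Fin n
    element-injective : ∀ {i j} → element i ≡ element j → i ≡ j
    element-valid     : ∀ i → P (element i)
    index             : ∀ {v} → P v → Fin size
    element-index     : ∀ {v} (pv : P v) → element (index pv) ≡ v

enumerate : ∀ {n} {P : Fin n → Set} → Decidable P → Enumeration P
enumerate {n} P? = record
  { size              = length members
  ; element           = lookupₗ members
  ; element-injective = lookup-injective (filter⁺ P? (allFin⁺ n))
  ; element-valid     = λ i → All.lookup (all-filter P? (allFin n)) (∈-lookup i)
  ; index             = λ {v} pv → Any.index (∈-filter⁺ P? (∈-allFin v) pv)
  ; element-index     = λ {v} pv → sym (lookup-index (∈-filter⁺ P? (∈-allFin v) pv))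
  }
  where
  members : List (Fin n)
  members = filter P? (allFin n)

-- Complementary graphs

Complementary : ∀ {n} → Graph n → Graph n → Set
Complementary G H = ∀ u v → u ≢ v → adj H u v ≡ not (adj G u v)

complement-complementary : ∀ {n} (G : Graph n) → Complementary G (complement G)
complement-complementary G u v u≢v with u ≟ᶠ v
... | yes u≡v = contradiction u≡v u≢v
... | no _    = refl

complementary-sym : ∀ {n} {G H : Graph n} → Complementary G H → Complementary H G
complementary-sym G~H u v u≢v = trans (sym (not-involutive _)) (cong not (sym (G~H u v u≢v)))

complementary-delete : ∀ {n} {G H : Graph (suc n)} → Complementary G H → ∀ v →
  Complementary (delete G v) (delete H v)
complementary-delete G~H v a b a≢b = G~H (punchIn v a) (punchIn v b) (a≢b ∘ punchIn-injective v a b)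

isCliqueColor-swap : ∀ {k ℓ} (x : Fin k ⊎ Fin ℓ) → isCliqueColor (swap x) ≡ not (isCliqueColor x)
isCliqueColor-swap (inj₁ _) = refl
isCliqueColor-swap (inj₂ _) = refl

module _ {n} {G H : Graph n} (G~H : Complementary G H) where

  proper-complementary : ∀ {k ℓ} {c : Fin n → Fin k ⊎ Fin ℓ} → Proper G c → Proper H (swap ∘ c)
  proper-complementary {c = c} ok u v u≢v same = begin
    adj H u v                  ≡⟨ G~H u v u≢v ⟩
    not (adj G u v)            ≡⟨ cong not (ok u v u≢v c-same) ⟩
    not (isCliqueColor (c u))  ≡⟨ sym (isCliqueColor-swap (c u)) ⟩
    isCliqueColor (swap (c u)) ∎
    where
    c-same : c u ≡ c v
    c-same = trans (sym (swap-involutive (c u))) (trans (cong swap same) (swap-involutive (c v)))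

  coloring-complementary : ∀ {k ℓ} → Coloring k ℓ G → Coloring ℓ k H
  coloring-complementary c = proper⇒coloring (proper-complementary (coloring⇒proper c))

  bicolorable-complementary : ∀ {z} → Bicolorable z G → Bicolorable z H
  bicolorable-complementary bic k ℓ k+ℓ≡z = coloring-complementary (bic ℓ k (trans (+-comm ℓ k) k+ℓ≡z))

minimalObstruction-complementary : ∀ {z n} {G H : Graph n} → Complementary G H →
  MinimalObstruction z G → MinimalObstruction z H
minimalObstruction-complementary {n = zero} G~H (¬bic , _) =
  ¬bic ∘ bicolorable-complementary (complementary-sym G~H) , tt
minimalObstruction-complementary {n = suc _} G~H (¬bic , del) =
  ¬bic ∘ bicolorable-complementary (complementary-sym G~H) ,
  λ v → bicolorable-complementary (complementary-delete G~H v) (del v)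

complement-loopless : ∀ {n} (G : Graph n) u → adj (complement G) u u ≡ false
complement-loopless G u with u ≟ᶠ u
... | yes _   = refl
... | no u≢u = contradiction refl u≢u

complement-simple : ∀ {n} {G : Graph n} → IsSimple G → IsSimple (complement G)
complement-simple {G = G} (G-sym , _) = sym′ , complement-loopless G
  where
  sym′ : ∀ u v → adj (complement G) u v ≡ adj (complement G) v u
  sym′ u v with u ≟ᶠ v
  ... | yes refl = sym (complement-loopless G u)
  ... | no u≢v   = trans (cong not (G-sym u v)) (sym (complement-complementary G v u (u≢v ∘ sym)))

coloring-fromComplement : ∀ {n k ℓ} {G : Graph n} → Coloring k ℓ (complement G) → Coloring ℓ k G
coloring-fromComplement {G = G} = coloring-complementary (complementary-sym (complement-complementary G))

-- Induced subgraphs and isomorphisms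

infix 4 _⊑_

record _⊑_ {m n} (H : Graph m) (G : Graph n) : Set where
  field
    embed           : Fin m → Fin n
    embed-injective : ∀ {x y} → embed x ≡ embed y → x ≡ y
    embed-adj       : ∀ x y → adj G (embed x) (embed y) ≡ adj H x y
open _⊑_

same-adj-⊑ : ∀ {n} {H G : Graph n} → (∀ u v → adj G u v ≡ adj H u v) → H ⊑ G
same-adj-⊑ same = record { embed = id ; embed-injective = id ; embed-adj = same }

⊑-refl : ∀ {n} {G : Graph n} → G ⊑ G
⊑-refl = same-adj-⊑ λ _ _ → refl

module _ {l m n} {F : Graph l} {H : Graph m} {G : Graph n} where

  ⊑-trans : F ⊑ H → H ⊑ G → F ⊑ G
  ⊑-trans E E′ = record
    { embed           = embed E′ ∘ embed E
    ; embed-injective = embed-injective E ∘ embed-injective E′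
    ; embed-adj       = λ x y → trans (embed-adj E′ (embed E x) (embed E y)) (embed-adj E x y)
    }

module _ {m n} {G : Graph m} {H : Graph n} (iso : G ≅ H) where
  open Inverse (proj₁ iso) using (to; from; strictlyInverseˡ; strictlyInverseʳ)

  ≅⇒⊑ : G ⊑ H
  ≅⇒⊑ = record
    { embed           = to
    ; embed-injective = λ {x} {y} eq → trans (sym (strictlyInverseʳ x)) (trans (cong from eq) (strictlyInverseʳ y))
    ; embed-adj       = proj₂ iso
    }

  ≅⇒⊒ : H ⊑ G
  ≅⇒⊒ = record
    { embed           = from
    ; embed-injective = λ {x} {y} eq → trans (sym (strictlyInverseˡ x)) (trans (cong to eq) (strictlyInverseˡ y))
    ; embed-adj       = λ x y → trans (sym (proj₂ iso (from x) (from y)))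
                                      (cong₂ (adj H) (strictlyInverseˡ x) (strictlyInverseˡ y))
    }

≅-refl : ∀ {n} {G : Graph n} → G ≅ G
≅-refl = ↔-refl , λ _ _ → refl

≅-trans : ∀ {l m n} {F : Graph l} {G : Graph m} {H : Graph n} → F ≅ G → G ≅ H → F ≅ H
≅-trans (f , f-adj) (g , g-adj) =
  ↔-trans f g , λ u v → trans (g-adj (Inverse.to f u) (Inverse.to f v)) (f-adj u v)

module _ {m n} {H : Graph m} {G : Graph n} (E : H ⊑ G) where

  coloring-⊑ : ∀ {k ℓ} → Coloring k ℓ G → Coloring k ℓ H
  coloring-⊑ c = proper⇒coloring λ x y x≢y same →
    trans (sym (embed-adj E x y)) (coloring⇒proper c (embed E x) (embed E y) (x≢y ∘ embed-injective E) same)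

  bicolorable-⊑ : ∀ {z} → Bicolorable z G → Bicolorable z H
  bicolorable-⊑ bic k ℓ k+ℓ≡z = coloring-⊑ (bic k ℓ k+ℓ≡z)

delete-⊑ : ∀ {n} (G : Graph (suc n)) v → delete G v ⊑ G
delete-⊑ G v = record
  { embed           = punchIn v
  ; embed-injective = punchIn-injective v _ _
  ; embed-adj       = λ _ _ → refl
  }

⊑-avoiding : ∀ {m n} {H : Graph m} {G : Graph (suc n)} (E : H ⊑ G) v →
  (∀ x → embed E x ≢ v) → H ⊑ delete G v
⊑-avoiding {G = G} E v avoids = record
  { embed           = λ x → punchOut (v≢ x)
  ; embed-injective = λ {x} {y} eq → embed-injective E (punchOut-injective (v≢ x) (v≢ y) eq)
  ; embed-adj       = λ x y → trans (cong₂ (adj G) (punchIn-punchOut (v≢ x)) (punchIn-punchOut (v≢ y)))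
                                    (embed-adj E x y)
  }
  where
  v≢ : ∀ x → v ≢ embed E x
  v≢ x = avoids x ∘ sym

⊑-delete : ∀ {m n} {H : Graph (suc m)} {G : Graph (suc n)} (E : H ⊑ G) v →
  delete H v ⊑ delete G (embed E v)
⊑-delete {H = H} E v = ⊑-avoiding (⊑-trans (delete-⊑ H v) E) (embed E v)
  (λ x eq → punchInᵢ≢i v x (embed-injective E eq))

allVertexDeletedBicolorable-⊑ : ∀ {z m n} {H : Graph m} {G : Graph n} → H ⊑ G →
  AllVertexDeletedBicolorable z G → AllVertexDeletedBicolorable z H
allVertexDeletedBicolorable-⊑ {m = zero}              E del = tt
allVertexDeletedBicolorable-⊑ {m = suc _} {n = zero}  E del v with embed E v
... | ()
allVertexDeletedBicolorable-⊑ {m = suc _} {n = suc _} E del v = bicolorable-⊑ (⊑-delete E v) (del (embed E v))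

⊑-surjective : ∀ {z m n} {H : Graph m} {G : Graph n} (E : H ⊑ G) → ¬ Bicolorable z H →
  AllVertexDeletedBicolorable z G → ∀ v → ∃ λ x → embed E x ≡ v
⊑-surjective {n = suc _} E ¬bic del v with any? (λ x → embed E x ≟ᶠ v)
... | yes hit = hit
... | no miss = contradiction (bicolorable-⊑ (⊑-avoiding E v (λ x eq → miss (x , eq))) (del v)) ¬bic

⊑-minimal⇒≅ : ∀ {z m n} {H : Graph m} {G : Graph n} (E : H ⊑ G) → ¬ Bicolorable z H →
  AllVertexDeletedBicolorable z G → G ≅ H
⊑-minimal⇒≅ {m = m} {n} {G = G} E ¬bic del =
  mk↔ₛ′ preimage (embed E) (λ x → embed-injective E (embed-preimage (embed E x))) embed-preimage ,
  λ u v → trans (sym (embed-adj E (preimage u) (preimage v))) (cong₂ (adj G) (embed-preimage u) (embed-preimage v))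
  where
  preimage : Fin n → Fin m
  preimage v = proj₁ (⊑-surjective E ¬bic del v)
  embed-preimage : ∀ v → embed E (preimage v) ≡ v
  embed-preimage v = proj₂ (⊑-surjective E ¬bic del v)

⊑-complement : ∀ {m n} {H : Graph m} {G : Graph n} → H ⊑ G → complement H ⊑ complement G
⊑-complement {H = H} {G} E = record
  { embed           = embed E
  ; embed-injective = embed-injective E
  ; embed-adj       = adj′
  }
  where
  adj′ : ∀ x y → adj (complement G) (embed E x) (embed E y) ≡ adj (complement H) x y
  adj′ x y with x ≟ᶠ y
  ... | yes refl = complement-loopless G (embed E x)
  ... | no x≢y   = trans (complement-complementary G _ _ (x≢y ∘ embed-injective E)) (cong not (embed-adj E x y))

complement-involutive : ∀ {n} {G : Graph n} → (∀ u → adj G u u ≡ false) →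
  ∀ u v → adj (complement (complement G)) u v ≡ adj G u v
complement-involutive loopless u v with u ≟ᶠ v
... | yes refl = sym (loopless u)
... | no _     = not-involutive _

complement-⊑ : ∀ {m n} {H : Graph m} {G : Graph n} → (∀ u → adj G u u ≡ false) →
  H ⊑ complement G → complement H ⊑ G
complement-⊑ loopless E =
  ⊑-trans (⊑-complement E) (same-adj-⊑ λ u v → sym (complement-involutive loopless u v))

-- Complete graphs

K-adj : ∀ {n} {u v : Fin n} → u ≢ v → adj (K n) u v ≡ true
K-adj {u = u} {v} u≢v with u ≟ᶠ v
... | yes u≡v = contradiction u≡v u≢v
... | no _    = refl

K-loopless : ∀ {n} (u : Fin n) → adj (K n) u u ≡ false
K-loopless u with u ≟ᶠ u
... | yes _   = refl
... | no u≢u = contradiction refl u≢u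

K-simple : ∀ n → IsSimple (K n)
K-simple n = sym′ , K-loopless
  where
  sym′ : ∀ u v → adj (K n) u v ≡ adj (K n) v u
  sym′ u v with u ≟ᶠ v
  ... | yes refl = sym (K-loopless u)
  ... | no u≢v   = sym (K-adj (u≢v ∘ sym))

K-cliqueColoring : ∀ {n} → Coloring 0 1 (K n)
K-cliqueColoring = proper⇒coloring {c = λ _ → inj₂ zero} λ u v u≢v _ → K-adj u≢v

clique-⊑ : ∀ {m n} {G : Graph n} → (∀ u → adj G u u ≡ false) →
  (g : Fin m → Fin n) → (∀ i j → i ≢ j → adj G (g i) (g j) ≡ true) → K m ⊑ G
clique-⊑ {m} {G = G} loopless g complete = record
  { embed           = g
  ; embed-injective = injective
  ; embed-adj       = adj′
  }
  where
  injective : ∀ {i j} → g i ≡ g j → i ≡ j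
  injective {i} {j} gi≡gj with i ≟ᶠ j
  ... | yes i≡j = i≡j
  ... | no i≢j  = contradiction gi≡gj (adjacent⇒distinct {G = G} loopless (complete i j i≢j))
  adj′ : ∀ i j → adj G (g i) (g j) ≡ adj (K m) i j
  adj′ i j with i ≟ᶠ j
  ... | yes refl = loopless (g i)
  ... | no i≢j   = complete i j i≢j

K-mono : ∀ {m n} → m ≤ n → K m ⊑ K n
K-mono m≤n = clique-⊑ K-loopless (λ i → inject≤ i m≤n)
  λ i j i≢j → K-adj (i≢j ∘ inject≤-injective m≤n m≤n i j)

coloring-or-clique : ∀ {n} {G : Graph n} → (∃ λ ω → K ω ⊑ G × Coloring ω 0 G) →
  ∀ z → Coloring z 0 G ⊎ K (suc z) ⊑ G
coloring-or-clique (ω , E , c) z with ω ≤? z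
... | yes ω≤z = inj₁ (coloring-weaken ω≤z ≤-refl c)
... | no  ω≰z = inj₂ (⊑-trans (K-mono (≰⇒> ω≰z)) E)

clique-rainbow : ∀ {m n k} {G : Graph n} (E : K m ⊑ G) (c : Coloring k 0 G) →
  Injective _≡_ _≡_ (independentColor ∘ Coloring.col c ∘ embed E)
clique-rainbow E c {i} {j} same with i ≟ᶠ j
... | yes i≡j = i≡j
... | no i≢j  = contradiction same
  (independentColor-adjacent c (i≢j ∘ embed-injective E) (trans (embed-adj E i j) (K-adj i≢j)))

K-notBicolorable : ∀ z → ¬ Bicolorable z (K (suc z))
K-notBicolorable z bic = 1+n≰n (injective⇒≤ (clique-rainbow ⊑-refl (bic z 0 (+-identityʳ z))))

K-deleteBicolorable : ∀ z v → Bicolorable z (delete (K (suc z)) v)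
K-deleteBicolorable z v k zero    k+0≡z =
  coloring-weaken (≤-reflexive (sym (trans (sym (+-identityʳ k)) k+0≡z))) ≤-refl (discreteColoring _)
K-deleteBicolorable z v k (suc ℓ) _     =
  coloring-weaken z≤n (s≤s z≤n) (coloring-⊑ (delete-⊑ (K (suc z)) v) K-cliqueColoring)

-- Joins and disjoint unions

module _ {m n} (A : Graph m) (B : Graph n) where

  joinAdj : Fin m ⊎ Fin n → Fin m ⊎ Fin n → Bool
  joinAdj (inj₁ a) (inj₁ a′) = adj A a a′
  joinAdj (inj₂ b) (inj₂ b′) = adj B b b′
  joinAdj _        _         = true

  unionAdj : Fin m ⊎ Fin n → Fin m ⊎ Fin n → Bool
  unionAdj (inj₁ a) (inj₁ a′) = adj A a a′
  unionAdj (inj₂ b) (inj₂ b′) = adj B b b′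
  unionAdj _        _         = false

  adj-⊕J : ∀ x y → adj (A ⊕J B) x y ≡ joinAdj (splitAt m x) (splitAt m y)
  adj-⊕J x y with splitAt m x | splitAt m y
  ... | inj₁ _ | inj₁ _ = refl
  ... | inj₁ _ | inj₂ _ = refl
  ... | inj₂ _ | inj₁ _ = refl
  ... | inj₂ _ | inj₂ _ = refl

  adj-⊕U : ∀ x y → adj (A ⊕U B) x y ≡ unionAdj (splitAt m x) (splitAt m y)
  adj-⊕U x y with splitAt m x | splitAt m y
  ... | inj₁ _ | inj₁ _ = refl
  ... | inj₁ _ | inj₂ _ = refl
  ... | inj₂ _ | inj₁ _ = refl
  ... | inj₂ _ | inj₂ _ = refl

  adj-⊕J-join : ∀ s t → adj (A ⊕J B) (join m n s) (join m n t) ≡ joinAdj s t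
  adj-⊕J-join s t = trans (adj-⊕J _ _) (cong₂ joinAdj (splitAt-join m n s) (splitAt-join m n t))

  ⊕J-inl : A ⊑ A ⊕J B
  ⊕J-inl = record
    { embed           = _↑ˡ n
    ; embed-injective = ↑ˡ-injective n _ _
    ; embed-adj       = λ a a′ → adj-⊕J-join (inj₁ a) (inj₁ a′)
    }

  ⊕J-inr : B ⊑ A ⊕J B
  ⊕J-inr = record
    { embed           = m ↑ʳ_
    ; embed-injective = ↑ʳ-injective m _ _
    ; embed-adj       = λ b b′ → adj-⊕J-join (inj₂ b) (inj₂ b′)
    }

data SplitView m n : Fin (m + n) → Set where
  left  : (a : Fin m) → SplitView m n (a ↑ˡ n)
  right : (b : Fin n) → SplitView m n (m ↑ʳ b)

splitView : ∀ m {n} (x : Fin (m + n)) → SplitView m n x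
splitView m {n} x = subst (SplitView m n) (join-splitAt m n x) (view (splitAt m x))
  where
  view : ∀ s → SplitView m n (join m n s)
  view (inj₁ a) = left a
  view (inj₂ b) = right b

module _ {m n} {A : Graph m} {B : Graph n} where

  ⊕J-simple : IsSimple A → IsSimple B → IsSimple (A ⊕J B)
  ⊕J-simple (A-sym , A-loopless) (B-sym , B-loopless) =
    (λ x y → trans (adj-⊕J A B x y) (trans (sym′ (splitAt m x) (splitAt m y)) (sym (adj-⊕J A B y x)))) ,
    (λ x → trans (adj-⊕J A B x x) (loopless′ (splitAt m x)))
    where
    sym′ : ∀ s t → joinAdj A B s t ≡ joinAdj A B t s
    sym′ (inj₁ a) (inj₁ a′) = A-sym a a′
    sym′ (inj₁ a) (inj₂ b)  = refl
    sym′ (inj₂ b) (inj₁ a)  = refl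
    sym′ (inj₂ b) (inj₂ b′) = B-sym b b′
    loopless′ : ∀ s → joinAdj A B s s ≡ false
    loopless′ (inj₁ a) = A-loopless a
    loopless′ (inj₂ b) = B-loopless b

  proper-⊕J : ∀ {C D : Set} (c : Fin m ⊎ Fin n → C ⊎ D) →
    (∀ s t → s ≢ t → c s ≡ c t → joinAdj A B s t ≡ isCliqueColor (c s)) → Proper (A ⊕J B) (c ∘ splitAt m)
  proper-⊕J c ok x y x≢y same = trans (adj-⊕J A B x y) (ok _ _ (x≢y ∘ splitAt-injective m) same)

  ⊕J-independentColoring : ∀ {a b} → Coloring a 0 A → Coloring b 0 B → Coloring (a + b) 0 (A ⊕J B)
  ⊕J-independentColoring {a} {b} cA cB = proper⇒coloring (proper-⊕J color ok)
    where
    colorA : Fin m → Fin a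
    colorA = independentColor ∘ Coloring.col cA
    colorB : Fin n → Fin b
    colorB = independentColor ∘ Coloring.col cB
    color : Fin m ⊎ Fin n → Fin (a + b) ⊎ Fin 0
    color = inj₁ ∘ join a b ∘ ⊎-map colorA colorB
    ok : ∀ s t → s ≢ t → color s ≡ color t → joinAdj A B s t ≡ false
    ok (inj₁ u) (inj₁ v) s≢t same =
      independentColor-proper cA (s≢t ∘ cong inj₁) (inj₁-injective (join-injective a b (inj₁-injective same)))
    ok (inj₂ u) (inj₂ v) s≢t same =
      independentColor-proper cB (s≢t ∘ cong inj₂) (inj₂-injective (join-injective a b (inj₁-injective same)))
    ok (inj₁ u) (inj₂ v) s≢t same with join-injective a b {inj₁ (colorA u)} {inj₂ (colorB v)} (inj₁-injective same)
    ... | ()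
    ok (inj₂ u) (inj₁ v) s≢t same with join-injective a b {inj₂ (colorB u)} {inj₁ (colorA v)} (inj₁-injective same)
    ... | ()

module _ {l m n} {A : Graph m} {B : Graph n} {G : Graph l} where

  ⊕J-⊑ : (∀ u → adj G u u ≡ false) → (EA : A ⊑ G) (EB : B ⊑ G) →
    (∀ a b → adj G (embed EA a) (embed EB b) ≡ true) → (∀ a b → adj G (embed EB b) (embed EA a) ≡ true) →
    A ⊕J B ⊑ G
  ⊕J-⊑ loopless EA EB AB BA = record
    { embed           = e ∘ splitAt m
    ; embed-injective = splitAt-injective m ∘ injective _ _
    ; embed-adj       = λ x y → trans (adj′ (splitAt m x) (splitAt m y)) (sym (adj-⊕J A B x y))
    }
    where
    e : Fin m ⊎ Fin n → Fin l
    e = [ embed EA , embed EB ]′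
    distinct : ∀ a b → embed EA a ≢ embed EB b
    distinct a b = adjacent⇒distinct {G = G} loopless (AB a b)
    injective : ∀ s t → e s ≡ e t → s ≡ t
    injective (inj₁ a) (inj₁ a′) eq = cong inj₁ (embed-injective EA eq)
    injective (inj₂ b) (inj₂ b′) eq = cong inj₂ (embed-injective EB eq)
    injective (inj₁ a) (inj₂ b)  eq = contradiction eq (distinct a b)
    injective (inj₂ b) (inj₁ a)  eq = contradiction (sym eq) (distinct a b)
    adj′ : ∀ s t → adj G (e s) (e t) ≡ joinAdj A B s t
    adj′ (inj₁ a) (inj₁ a′) = embed-adj EA a a′
    adj′ (inj₂ b) (inj₂ b′) = embed-adj EB b b′
    adj′ (inj₁ a) (inj₂ b)  = AB a b
    adj′ (inj₂ b) (inj₁ a)  = BA a b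

splitAt-punchIn-↑ˡ : ∀ m {n} (a : Fin (suc m)) (x : Fin (m + n)) →
  splitAt (suc m) (punchIn (a ↑ˡ n) x) ≡ ⊎-map (punchIn a) id (splitAt m x)
splitAt-punchIn-↑ˡ zero    zero    x       = refl
splitAt-punchIn-↑ˡ (suc m) zero    x       = refl
splitAt-punchIn-↑ˡ (suc m) (suc a) zero    = refl
splitAt-punchIn-↑ˡ (suc m) (suc a) (suc x) rewrite splitAt-punchIn-↑ˡ m a x with splitAt m x
... | inj₁ _ = refl
... | inj₂ _ = refl

-- Stated for a left summand of size 5 only: for a variable size m, m + suc n is not definitionally
-- a successor, so a vertex of the right summand could not even be deleted.
splitAt-punchIn-5↑ʳ : ∀ {n} (t : Fin (suc n)) (x : Fin (5 + n)) →
  splitAt 5 (punchIn (5 ↑ʳ t) x) ≡ ⊎-map id (punchIn t) (splitAt 5 x)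
splitAt-punchIn-5↑ʳ t zero                                = refl
splitAt-punchIn-5↑ʳ t (suc zero)                          = refl
splitAt-punchIn-5↑ʳ t (suc (suc zero))                    = refl
splitAt-punchIn-5↑ʳ t (suc (suc (suc zero)))              = refl
splitAt-punchIn-5↑ʳ t (suc (suc (suc (suc zero))))        = refl
splitAt-punchIn-5↑ʳ t (suc (suc (suc (suc (suc x)))))     = refl

delete-⊕J-⊑ˡ : ∀ {m n} (A : Graph (suc m)) (B : Graph n) a → delete (A ⊕J B) (a ↑ˡ n) ⊑ delete A a ⊕J B
delete-⊕J-⊑ˡ {m} {n} A B a = same-adj-⊑ λ x y → begin
  adj (delete A a ⊕J B) x y                                 ≡⟨ adj-⊕J (delete A a) B x y ⟩
  joinAdj (delete A a) B (splitAt m x) (splitAt m y)        ≡⟨ punched (splitAt m x) (splitAt m y) ⟩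
  joinAdj A B (⊎-map (punchIn a) id (splitAt m x)) (⊎-map (punchIn a) id (splitAt m y))
    ≡⟨ sym (cong₂ (joinAdj A B) (splitAt-punchIn-↑ˡ m a x) (splitAt-punchIn-↑ˡ m a y)) ⟩
  joinAdj A B (splitAt (suc m) (punchIn (a ↑ˡ n) x)) (splitAt (suc m) (punchIn (a ↑ˡ n) y))
    ≡⟨ sym (adj-⊕J A B (punchIn (a ↑ˡ n) x) (punchIn (a ↑ˡ n) y)) ⟩
  adj (delete (A ⊕J B) (a ↑ˡ n)) x y                        ∎
  where
  punched : ∀ s t → joinAdj (delete A a) B s t ≡ joinAdj A B (⊎-map (punchIn a) id s) (⊎-map (punchIn a) id t)
  punched (inj₁ _) (inj₁ _) = refl
  punched (inj₁ _) (inj₂ _) = refl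
  punched (inj₂ _) (inj₁ _) = refl
  punched (inj₂ _) (inj₂ _) = refl

delete-⊕J-⊑ʳ : ∀ {n} (A : Graph 5) (B : Graph (suc n)) t → delete (A ⊕J B) (5 ↑ʳ t) ⊑ A ⊕J delete B t
delete-⊕J-⊑ʳ A B t = same-adj-⊑ λ x y → begin
  adj (A ⊕J delete B t) x y                                 ≡⟨ adj-⊕J A (delete B t) x y ⟩
  joinAdj A (delete B t) (splitAt 5 x) (splitAt 5 y)        ≡⟨ punched (splitAt 5 x) (splitAt 5 y) ⟩
  joinAdj A B (⊎-map id (punchIn t) (splitAt 5 x)) (⊎-map id (punchIn t) (splitAt 5 y))
    ≡⟨ sym (cong₂ (joinAdj A B) (splitAt-punchIn-5↑ʳ t x) (splitAt-punchIn-5↑ʳ t y)) ⟩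
  joinAdj A B (splitAt 5 (punchIn (5 ↑ʳ t) x)) (splitAt 5 (punchIn (5 ↑ʳ t) y))
    ≡⟨ sym (adj-⊕J A B (punchIn (5 ↑ʳ t) x) (punchIn (5 ↑ʳ t) y)) ⟩
  adj (delete (A ⊕J B) (5 ↑ʳ t)) x y                        ∎
  where
  punched : ∀ s u → joinAdj A (delete B t) s u ≡ joinAdj A B (⊎-map id (punchIn t) s) (⊎-map id (punchIn t) u)
  punched (inj₁ _) (inj₁ _) = refl
  punched (inj₁ _) (inj₂ _) = refl
  punched (inj₂ _) (inj₁ _) = refl
  punched (inj₂ _) (inj₂ _) = refl

complement-⊕J : ∀ {m n} (A : Graph m) (B : Graph n) → complement A ⊕U complement B ≅ complement (A ⊕J B)
complement-⊕J {m} A B = ↔-refl , adj′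
  where
  diagonal : ∀ s → unionAdj (complement A) (complement B) s s ≡ false
  diagonal (inj₁ a) = complement-loopless A a
  diagonal (inj₂ b) = complement-loopless B b
  offDiagonal : ∀ s t → s ≢ t → not (joinAdj A B s t) ≡ unionAdj (complement A) (complement B) s t
  offDiagonal (inj₁ a) (inj₁ a′) s≢t = sym (complement-complementary A a a′ (s≢t ∘ cong inj₁))
  offDiagonal (inj₂ b) (inj₂ b′) s≢t = sym (complement-complementary B b b′ (s≢t ∘ cong inj₂))
  offDiagonal (inj₁ a) (inj₂ b)  s≢t = refl
  offDiagonal (inj₂ b) (inj₁ a)  s≢t = refl
  adj′ : ∀ u v → adj (complement (A ⊕J B)) u v ≡ adj (complement A ⊕U complement B) u v
  adj′ u v with u ≟ᶠ v
  ... | yes refl = sym (trans (adj-⊕U (complement A) (complement B) u u) (diagonal (splitAt m u)))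
  ... | no u≢v   = begin
    not (adj (A ⊕J B) u v)                               ≡⟨ cong not (adj-⊕J A B u v) ⟩
    not (joinAdj A B (splitAt m u) (splitAt m v))        ≡⟨ offDiagonal _ _ (u≢v ∘ splitAt-injective m) ⟩
    unionAdj (complement A) (complement B) (splitAt m u) (splitAt m v)
      ≡⟨ sym (adj-⊕U (complement A) (complement B) u v) ⟩
    adj (complement A ⊕U complement B) u v               ∎

⊕U-cong : ∀ {m m′ n n′} {A : Graph m} {A′ : Graph m′} {B : Graph n} {B′ : Graph n′} →
  A ≅ A′ → B ≅ B′ → A ⊕U B ≅ A′ ⊕U B′
⊕U-cong {m} {m′} {n′ = n′} {A} {A′} {B} {B′} (f , f-adj) (g , g-adj) =
  mk↔ₛ′ (lift F.to G.to) (lift F.from G.from)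
        (lift-inverse F.to F.from G.to G.from F.strictlyInverseˡ G.strictlyInverseˡ)
        (lift-inverse F.from F.to G.from G.to F.strictlyInverseʳ G.strictlyInverseʳ) ,
  λ u v → begin
    adj (A′ ⊕U B′) (lift F.to G.to u) (lift F.to G.to v)
      ≡⟨ adj-⊕U A′ B′ (lift F.to G.to u) (lift F.to G.to v) ⟩
    unionAdj A′ B′ (splitAt m′ (lift F.to G.to u)) (splitAt m′ (lift F.to G.to v))
      ≡⟨ cong₂ (unionAdj A′ B′) (splitAt-join m′ n′ (⊎-map F.to G.to (splitAt m u)))
                                (splitAt-join m′ n′ (⊎-map F.to G.to (splitAt m v))) ⟩
    unionAdj A′ B′ (⊎-map F.to G.to (splitAt m u)) (⊎-map F.to G.to (splitAt m v))
      ≡⟨ adj′ (splitAt m u) (splitAt m v) ⟩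
    unionAdj A B (splitAt m u) (splitAt m v)
      ≡⟨ sym (adj-⊕U A B u v) ⟩
    adj (A ⊕U B) u v ∎
  where
  module F = Inverse f
  module G = Inverse g
  lift : ∀ {k k′ l l′} → (Fin k → Fin k′) → (Fin l → Fin l′) → Fin (k + l) → Fin (k′ + l′)
  lift {k} {k′} {l} {l′} h i = join k′ l′ ∘ ⊎-map h i ∘ splitAt k
  lift-inverse : ∀ {k k′ l l′} (h : Fin k → Fin k′) (h′ : Fin k′ → Fin k) →
    (i : Fin l → Fin l′) (i′ : Fin l′ → Fin l) →
    (∀ a → h (h′ a) ≡ a) → (∀ b → i (i′ b) ≡ b) → ∀ x → lift h i (lift h′ i′ x) ≡ x
  lift-inverse {k} {k′} {l} {l′} h h′ i i′ hh′ ii′ x = begin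
    join k′ l′ (⊎-map h i (splitAt k (join k l (⊎-map h′ i′ (splitAt k′ x)))))
      ≡⟨ cong (join k′ l′ ∘ ⊎-map h i) (splitAt-join k l (⊎-map h′ i′ (splitAt k′ x))) ⟩
    join k′ l′ (⊎-map h i (⊎-map h′ i′ (splitAt k′ x)))
      ≡⟨ cong (join k′ l′) (round-trip (splitAt k′ x)) ⟩
    join k′ l′ (splitAt k′ x)
      ≡⟨ join-splitAt k′ l′ x ⟩
    x ∎
    where
    round-trip : ∀ s → ⊎-map h i (⊎-map h′ i′ s) ≡ s
    round-trip (inj₁ a) = cong inj₁ (hh′ a)
    round-trip (inj₂ b) = cong inj₂ (ii′ b)
  adj′ : ∀ s t → unionAdj A′ B′ (⊎-map F.to G.to s) (⊎-map F.to G.to t) ≡ unionAdj A B s t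
  adj′ (inj₁ a) (inj₁ a′) = f-adj a a′
  adj′ (inj₂ b) (inj₂ b′) = g-adj b b′
  adj′ (inj₁ a) (inj₂ b)  = refl
  adj′ (inj₂ b) (inj₁ a)  = refl

-- The 5-cycle

C5-simple : IsSimple C5
C5-simple = from-yes (all? λ i → all? λ j → adj C5 i j ≟ᵇ adj C5 j i) ,
            from-yes (all? λ i → adj C5 i i ≟ᵇ false)

C5-selfComplementary : C5 ≅ complement C5
C5-selfComplementary =
  mk↔ₛ′ σ σ⁻¹ (from-yes (all? λ i → σ (σ⁻¹ i) ≟ᶠ i)) (from-yes (all? λ i → σ⁻¹ (σ i) ≟ᶠ i)) ,
  from-yes (all? λ i → all? λ j → adj (complement C5) (σ i) (σ j) ≟ᵇ adj C5 i j)
  where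
  σ σ⁻¹ : Fin 5 → Fin 5
  σ   = lookup (# 0 ∷ # 2 ∷ # 4 ∷ # 1 ∷ # 3 ∷ [])
  σ⁻¹ = lookup (# 0 ∷ # 3 ∷ # 1 ∷ # 4 ∷ # 2 ∷ [])

K2-⊑-C5 : K 2 ⊑ C5
K2-⊑-C5 = clique-⊑ (proj₂ C5-simple) edge
  (from-yes (all? λ i → all? λ j → ¬? (i ≟ᶠ j) →-dec (adj C5 (edge i) (edge j) ≟ᵇ true)))
  where
  edge : Fin 2 → Fin 5
  edge = lookup (# 0 ∷ # 1 ∷ [])

C5-coloring : ∀ {k ℓ} (c : Fin 5 → Fin k ⊎ Fin ℓ) → {_ : True (proper? C5 c)} → Coloring k ℓ C5
C5-coloring c {ok} = proper⇒coloring (toWitness ok)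

C5-independent₃ : Coloring 3 0 C5
C5-independent₃ = C5-coloring (lookup (inj₁ (# 0) ∷ inj₁ (# 1) ∷ inj₁ (# 0) ∷ inj₁ (# 1) ∷ inj₁ (# 2) ∷ []))

C5-cliques₃ : Coloring 0 3 C5
C5-cliques₃ = C5-coloring (lookup (inj₂ (# 0) ∷ inj₂ (# 0) ∷ inj₂ (# 1) ∷ inj₂ (# 1) ∷ inj₂ (# 2) ∷ []))

C5-mixed₂₁ : Coloring 2 1 C5
C5-mixed₂₁ = C5-coloring (lookup (inj₂ (# 0) ∷ inj₂ (# 0) ∷ inj₁ (# 0) ∷ inj₁ (# 1) ∷ inj₁ (# 0) ∷ []))

C5-mixed₁₂ : Coloring 1 2 C5
C5-mixed₁₂ = C5-coloring (lookup (inj₁ (# 0) ∷ inj₂ (# 0) ∷ inj₁ (# 0) ∷ inj₂ (# 1) ∷ inj₂ (# 1) ∷ []))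

-- offset v i is the distance from v to i around the cycle: delete C5 v is the path of offsets 1-2-3-4,
-- and the colorings of delete C5 v below are given as colorings of that path.
offset : Fin 5 → Fin 5 → Fin 5
offset v i = (toℕ i + 5 ∸ toℕ v) mod 5

C5-deleteColoring : ∀ {k ℓ} (path : Fin 5 → Fin k ⊎ Fin ℓ) →
  {_ : True (all? λ v → proper? (delete C5 v) (path ∘ offset v ∘ punchIn v))} →
  ∀ v → Coloring k ℓ (delete C5 v)
C5-deleteColoring path {ok} v = proper⇒coloring (toWitness ok v)

C5-deleteIndependent₂ : ∀ v → Coloring 2 0 (delete C5 v)
C5-deleteIndependent₂ =
  C5-deleteColoring (lookup (inj₁ (# 0) ∷ inj₁ (# 0) ∷ inj₁ (# 1) ∷ inj₁ (# 0) ∷ inj₁ (# 1) ∷ []))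

C5-deleteBicolorable : ∀ v → Bicolorable 2 (delete C5 v)
C5-deleteBicolorable v = bicolorable (C5-deleteIndependent₂ v)
  (C5-deleteColoring (lookup (inj₂ (# 0) ∷ inj₂ (# 0) ∷ inj₂ (# 0) ∷ inj₂ (# 1) ∷ inj₂ (# 1) ∷ [])) v)
  λ { zero          _ refl →
        C5-deleteColoring (lookup (inj₁ (# 0) ∷ inj₁ (# 0) ∷ inj₂ (# 0) ∷ inj₂ (# 0) ∷ inj₁ (# 0) ∷ [])) v
    ; (suc zero)    _ ()
    ; (suc (suc _)) _ () }

triple-injective : ∀ {A X : Set} (d : A → X) {a b c : A} → d a ≢ d b → d a ≢ d c → d b ≢ d c →
  Injective _≡_ _≡_ (d ∘ lookup (a ∷ b ∷ c ∷ []))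
triple-injective d ab ac bc {zero}           {zero}           _  = refl
triple-injective d ab ac bc {suc zero}       {suc zero}       _  = refl
triple-injective d ab ac bc {suc (suc zero)} {suc (suc zero)} _  = refl
triple-injective d ab ac bc {zero}           {suc zero}       eq = contradiction eq ab
triple-injective d ab ac bc {zero}           {suc (suc zero)} eq = contradiction eq ac
triple-injective d ab ac bc {suc zero}       {zero}           eq = contradiction (sym eq) ab
triple-injective d ab ac bc {suc zero}       {suc (suc zero)} eq = contradiction eq bc
triple-injective d ab ac bc {suc (suc zero)} {zero}           eq = contradiction (sym eq) ac
triple-injective d ab ac bc {suc (suc zero)} {suc zero}       eq = contradiction (sym eq) bc

C5-rainbow : ∀ {k} (d : Fin 5 → Fin k) → (∀ i j → adj C5 i j ≡ true → d i ≢ d j) →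
  Σ (Fin 3 → Fin 5) λ t → Injective _≡_ _≡_ (d ∘ t)
C5-rainbow d edge with d (# 0) ≟ᶠ d (# 2) | d (# 1) ≟ᶠ d (# 3)
... | no d0≢d2  | _         = lookup (# 0 ∷ # 1 ∷ # 2 ∷ []) ,
  triple-injective d (edge (# 0) (# 1) refl) d0≢d2 (edge (# 1) (# 2) refl)
... | yes d0≡d2 | no d1≢d3  = lookup (# 0 ∷ # 1 ∷ # 3 ∷ []) ,
  triple-injective d (edge (# 0) (# 1) refl) (λ eq → edge (# 2) (# 3) refl (trans (sym d0≡d2) eq)) d1≢d3
... | yes d0≡d2 | yes d1≡d3 = lookup (# 0 ∷ # 1 ∷ # 4 ∷ []) ,
  triple-injective d (edge (# 0) (# 1) refl) (λ eq → edge (# 4) (# 0) refl (sym eq))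
                   (λ eq → edge (# 3) (# 4) refl (trans (sym d1≡d3) eq))

C5-color-bound : ∀ {k} → Coloring k 0 C5 → 3 ≤ k
C5-color-bound c = injective⇒≤ (proj₂ (C5-rainbow (independentColor ∘ Coloring.col c)
  λ i j ij → independentColor-adjacent c (adjacent⇒distinct (proj₂ C5-simple) ij) ij))

C5-notBicolorable : ¬ Bicolorable 2 C5
C5-notBicolorable bic = contradiction (C5-color-bound (bic 2 0 refl)) λ { (s≤s (s≤s ())) }

-- Pseudo-split graphs

_≟ₚ_ : DecidableEquality Part
pC ≟ₚ pC = yes refl
pC ≟ₚ pS = no λ ()
pC ≟ₚ pI = no λ ()
pS ≟ₚ pC = no λ ()
pS ≟ₚ pS = yes refl
pS ≟ₚ pI = no λ ()
pI ≟ₚ pC = no λ ()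
pI ≟ₚ pS = no λ ()
pI ≟ₚ pI = yes refl

dualPart : Part → Part
dualPart pC = pI
dualPart pS = pS
dualPart pI = pC

dualPart-flip : ∀ {x y} → dualPart x ≡ y → x ≡ dualPart y
dualPart-flip {pC} refl = refl
dualPart-flip {pS} refl = refl
dualPart-flip {pI} refl = refl

differentParts : ∀ {n} (p : Fin n → Part) {u v x y} → p u ≡ x → p v ≡ y → x ≢ y → u ≢ v
differentParts p pu pv x≢y refl = x≢y (trans (sym pu) pv)

inducesC5⇒⊑ : ∀ {n} {G : Graph n} {p} → InducesC5 G p → C5 ⊑ G
inducesC5⇒⊑ (f , f-injective , _ , _ , f-adj) = record
  { embed = f ; embed-injective = f-injective _ _ ; embed-adj = f-adj }

complement-inducesC5 : ∀ {n} {G : Graph n} {p} → InducesC5 G p → InducesC5 (complement G) (dualPart ∘ p)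
complement-inducesC5 {G = G} {p} c5@(f , _ , f-S , f-onto , _) =
  embed E , (λ i j → embed-injective E) , (λ i → cong dualPart (f-S (σ i))) , onto , embed-adj E
  where
  open Inverse (proj₁ C5-selfComplementary) renaming (to to σ; from to σ⁻¹)
  E : C5 ⊑ complement G
  E = ⊑-trans (≅⇒⊑ C5-selfComplementary) (⊑-complement (inducesC5⇒⊑ {G = G} c5))
  onto : ∀ v → dualPart (p v) ≡ pS → ∃ λ i → f (σ i) ≡ v
  onto v pv with f-onto v (dualPart-flip pv)
  ... | i , fi≡v = σ⁻¹ i , trans (cong f (strictlyInverseˡ i)) fi≡v

complement-pseudoSplit : ∀ {n} {G : Graph n} → PseudoSplit G → PseudoSplit (complement G)
complement-pseudoSplit {G = G} (p , CC , II , S? , CS , IS) = dualPart ∘ p , CC′ , II′ , S?′ S? , CS′ , IS′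
  where
  G~G′ : Complementary G (complement G)
  G~G′ = complement-complementary G
  CC′ : ∀ u v → u ≢ v → dualPart (p u) ≡ pC → dualPart (p v) ≡ pC → adj (complement G) u v ≡ true
  CC′ u v u≢v pu pv = trans (G~G′ u v u≢v) (cong not (II u v (dualPart-flip pu) (dualPart-flip pv)))
  II′ : ∀ u v → dualPart (p u) ≡ pI → dualPart (p v) ≡ pI → adj (complement G) u v ≡ false
  II′ u v pu pv with u ≟ᶠ v
  ... | yes refl = refl
  ... | no u≢v   = cong not (CC u v u≢v (dualPart-flip pu) (dualPart-flip pv))
  CS′ : ∀ u v → dualPart (p u) ≡ pC → dualPart (p v) ≡ pS → adj (complement G) u v ≡ true
  CS′ u v pu pv = trans (G~G′ u v (differentParts p (dualPart-flip pu) (dualPart-flip pv) λ ()))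
                        (cong not (IS u v (dualPart-flip pu) (dualPart-flip pv)))
  IS′ : ∀ u v → dualPart (p u) ≡ pI → dualPart (p v) ≡ pS → adj (complement G) u v ≡ false
  IS′ u v pu pv = trans (G~G′ u v (differentParts p (dualPart-flip pu) (dualPart-flip pv) λ ()))
                        (cong not (CS u v (dualPart-flip pu) (dualPart-flip pv)))
  S?′ : (∀ v → ¬ p v ≡ pS) ⊎ InducesC5 G p →
        (∀ v → ¬ dualPart (p v) ≡ pS) ⊎ InducesC5 (complement G) (dualPart ∘ p)
  S?′ (inj₁ noS) = inj₁ λ v → noS v ∘ dualPart-flip
  S?′ (inj₂ c5)  = inj₂ (complement-inducesC5 {G = G} c5)

pseudoSplit-≅ : ∀ {m n} {G : Graph m} {H : Graph n} → G ≅ H → PseudoSplit H → PseudoSplit G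
pseudoSplit-≅ {G = G} {H} iso (p , CC , II , S? , CS , IS) =
  p ∘ to ,
  (λ u v u≢v pu pv → trans (sym (iso-adj u v)) (CC _ _ (u≢v ∘ embed-injective (≅⇒⊑ {G = G} {H} iso)) pu pv)) ,
  (λ u v pu pv → trans (sym (iso-adj u v)) (II _ _ pu pv)) ,
  S?′ S? ,
  (λ u v pu pv → trans (sym (iso-adj u v)) (CS _ _ pu pv)) ,
  (λ u v pu pv → trans (sym (iso-adj u v)) (IS _ _ pu pv))
  where
  open Inverse (proj₁ iso)
  iso-adj : ∀ u v → adj H (to u) (to v) ≡ adj G u v
  iso-adj = proj₂ iso
  S?′ : (∀ v → ¬ p v ≡ pS) ⊎ InducesC5 H p → (∀ v → ¬ p (to v) ≡ pS) ⊎ InducesC5 G (p ∘ to)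
  S?′ (inj₁ noS) = inj₁ (noS ∘ to)
  S?′ (inj₂ c5@(f , _ , f-S , f-onto , _)) =
    inj₂ (embed E , (λ i j → embed-injective E) , (λ i → trans (cong p (strictlyInverseˡ (f i))) (f-S i)) ,
          onto , embed-adj E)
    where
    E : C5 ⊑ G
    E = ⊑-trans (inducesC5⇒⊑ {G = H} c5) (≅⇒⊒ {G = G} {H} iso)
    onto : ∀ v → p (to v) ≡ pS → ∃ λ i → from (f i) ≡ v
    onto v pv with f-onto (to v) pv
    ... | i , fi≡tv = i , trans (cong from fi≡tv) (strictlyInverseʳ v)

inFps-≅ : ∀ {z m n} {G : Graph m} {H : Graph n} → G ≅ H → InFps z H → InFps z G
inFps-≅ {G = G} {H} iso (ps , ¬bic , del) =
  pseudoSplit-≅ iso ps , ¬bic ∘ bicolorable-⊑ (≅⇒⊒ {G = G} {H} iso) ,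
  allVertexDeletedBicolorable-⊑ (≅⇒⊑ {G = G} {H} iso) del

complement-inFps : ∀ {z n} {G : Graph n} → InFps z G → InFps z (complement G)
complement-inFps {G = G} (ps , mo) = complement-pseudoSplit ps , minimalObstruction-complementary (complement-complementary G) mo

module PseudoSplitColorings {n} {G : Graph n} (simple : IsSimple G) (p : Fin n → Part)
  (CC : ∀ u v → u ≢ v → p u ≡ pC → p v ≡ pC → adj G u v ≡ true)
  (II : ∀ u v → p u ≡ pI → p v ≡ pI → adj G u v ≡ false)
  (CS : ∀ u v → p u ≡ pC → p v ≡ pS → adj G u v ≡ true)
  (IS : ∀ u v → p u ≡ pI → p v ≡ pS → adj G u v ≡ false) where

  private
    G-sym : ∀ u v → adj G u v ≡ adj G v u
    G-sym = proj₁ simple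
    loopless : ∀ u → adj G u u ≡ false
    loopless = proj₂ simple

  data PartView (v : Fin n) : Set where
    inC : p v ≡ pC → PartView v
    inS : p v ≡ pS → PartView v
    inI : p v ≡ pI → PartView v

  partView : ∀ v → PartView v
  partView v with p v in pv
  ... | pC = inC pv
  ... | pS = inS pv
  ... | pI = inI pv

  open Enumeration (enumerate (λ v → p v ≟ₚ pC)) public

  index-injective : ∀ {u v} (pu : p u ≡ pC) (pv : p v ≡ pC) → index pu ≡ index pv → u ≡ v
  index-injective pu pv eq = trans (sym (element-index pu)) (trans (cong element eq) (element-index pv))

  element-adjacent : ∀ i j → i ≢ j → adj G (element i) (element j) ≡ true
  element-adjacent i j i≢j = CC _ _ (i≢j ∘ element-injective) (element-valid i) (element-valid j)

  K-⊑ : ∀ {m} → m ≤ size → K m ⊑ G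
  K-⊑ m≤size = clique-⊑ loopless (element ∘ λ i → inject≤ i m≤size)
    λ i j i≢j → element-adjacent _ _ (i≢j ∘ inject≤-injective m≤size m≤size i j)

  module Split (noS : ∀ v → ¬ p v ≡ pS) where

    mixed : Coloring 1 1 G
    mixed = proper⇒coloring ok
      where
      color : ∀ {v} → PartView v → Fin 1 ⊎ Fin 1
      color (inC _) = inj₂ zero
      color (inS _) = inj₁ zero
      color (inI _) = inj₁ zero
      ok : Proper G (color ∘ partView)
      ok u v u≢v same with partView u | partView v
      ... | inC pu | inC pv = CC u v u≢v pu pv
      ... | inI pu | inI pv = II u v pu pv
      ... | inS pu | _      = contradiction pu (noS u)
      ... | _      | inS pv = contradiction pv (noS v)

    coloring : ∀ {k} (κ : Fin size → Fin k) → Injective _≡_ _≡_ κ → (ι : ∀ v → p v ≡ pI → Fin k) →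
      (∀ v (pv : p v ≡ pI) i → ι v pv ≡ κ i → adj G v (element i) ≡ false) → Coloring k 0 G
    coloring {k} κ κ-injective ι ι-misses = proper⇒coloring ok
      where
      color : ∀ {v} → PartView v → Fin k ⊎ Fin 0
      color     (inC pv) = inj₁ (κ (index pv))
      color {v} (inS pv) = contradiction pv (noS v)
      color {v} (inI pv) = inj₁ (ι v pv)
      ok : Proper G (color ∘ partView)
      ok u v u≢v same with partView u | partView v
      ... | inC pu | inC pv = contradiction (index-injective pu pv (κ-injective (inj₁-injective same))) u≢v
      ... | inI pu | inI pv = II u v pu pv
      ... | inI pu | inC pv =
        trans (cong (adj G u) (sym (element-index pv))) (ι-misses u pu (index pv) (inj₁-injective same))
      ... | inC pu | inI pv = trans (G-sym u v)
        (trans (cong (adj G v) (sym (element-index pu))) (ι-misses v pv (index pu) (sym (inj₁-injective same))))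
      ... | inS pu | _      = contradiction pu (noS u)
      ... | _      | inS pv = contradiction pv (noS v)

    -- If some vertex of I is complete to C it extends C to a clique, and |C| + 1 colors suffice;
    -- otherwise every vertex of I takes the color of a vertex of C it misses.
    perfect : ∃ λ ω → K ω ⊑ G × Coloring ω 0 G
    perfect with any? (λ x → (p x ≟ₚ pI) ×-dec all? (λ i → adj G x (element i) ≟ᵇ true))
    ... | yes (x , px , x-complete) =
      suc size , clique-⊑ loopless (extend x) complete , coloring suc suc-injective (λ _ _ → zero) λ _ _ _ ()
      where
      extend : Fin n → Fin (suc size) → Fin n
      extend x zero    = x
      extend x (suc i) = element i
      complete : ∀ i j → i ≢ j → adj G (extend x i) (extend x j) ≡ true
      complete zero    zero    i≢j = contradiction refl i≢j
      complete zero    (suc j) _   = x-complete j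
      complete (suc i) zero    _   = trans (G-sym _ _) (x-complete i)
      complete (suc i) (suc j) i≢j = element-adjacent i j (i≢j ∘ cong suc)
    ... | no none = size , K-⊑ ≤-refl , coloring id id (λ v pv → proj₁ (missed v pv)) misses
      where
      missed : ∀ v → p v ≡ pI → ∃ λ i → adj G v (element i) ≡ false
      missed v pv with ¬∀⟶∃¬ size _ (λ i → adj G v (element i) ≟ᵇ true) (λ all → none (v , pv , all))
      ... | i , ¬adj = i , ¬-not ¬adj
      misses : ∀ v (pv : p v ≡ pI) i → proj₁ (missed v pv) ≡ i → adj G v (element i) ≡ false
      misses v pv i refl = proj₂ (missed v pv)

  module WithC5 (c5 : InducesC5 G p) where

    private
      f : Fin 5 → Fin n
      f = proj₁ c5
      f-S : ∀ i → p (f i) ≡ pS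
      f-S = proj₁ (proj₂ (proj₂ c5))
      f-onto : ∀ v → p v ≡ pS → ∃ λ i → f i ≡ v
      f-onto = proj₁ (proj₂ (proj₂ (proj₂ c5)))
      f-adj : ∀ i j → adj G (f i) (f j) ≡ adj C5 i j
      f-adj = proj₂ (proj₂ (proj₂ (proj₂ c5)))

    position : ∀ {v} → p v ≡ pS → Fin 5
    position {v} pv = proj₁ (f-onto v pv)

    f-position : ∀ {v} (pv : p v ≡ pS) → f (position pv) ≡ v
    f-position {v} pv = proj₂ (f-onto v pv)

    position-adj : ∀ {u v} (pu : p u ≡ pS) (pv : p v ≡ pS) → adj G u v ≡ adj C5 (position pu) (position pv)
    position-adj pu pv = trans (sym (cong₂ (adj G) (f-position pu) (f-position pv))) (f-adj _ _)

    position-distinct : ∀ {u v} (pu : p u ≡ pS) (pv : p v ≡ pS) → u ≢ v → position pu ≢ position pv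
    position-distinct pu pv u≢v eq = u≢v (trans (sym (f-position pu)) (trans (cong f eq) (f-position pv)))

    -- C is complete to S, so it joins a clique class of S;
    -- I is anticomplete to S, so it joins an independent one.
    mixed : ∀ {a b} → Coloring (suc a) (suc b) C5 → Coloring (suc a) (suc b) G
    mixed {a} {b} t = proper⇒coloring ok
      where
      color : ∀ {v} → PartView v → Fin (suc a) ⊎ Fin (suc b)
      color (inC _)  = inj₂ zero
      color (inS pv) = Coloring.col t (position pv)
      color (inI _)  = inj₁ zero
      ok : Proper G (color ∘ partView)
      ok u v u≢v same with partView u | partView v
      ... | inC pu | inC pv = CC u v u≢v pu pv
      ... | inC pu | inS pv = CS u v pu pv
      ... | inS pu | inC pv = trans (G-sym u v) (trans (CS v u pv pu) (sym (cong isCliqueColor same)))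
      ... | inS pu | inS pv = trans (position-adj pu pv) (coloring⇒proper t _ _ (position-distinct pu pv u≢v) same)
      ... | inS pu | inI pv = trans (G-sym u v) (trans (IS v u pv pu) (sym (cong isCliqueColor same)))
      ... | inI pu | inS pv = IS u v pu pv
      ... | inI pu | inI pv = II u v pu pv

    independent : Coloring (3 + size) 0 G
    independent = proper⇒coloring (proper-map (join-injective 3 size) id ok)
      where
      color : ∀ {v} → PartView v → (Fin 3 ⊎ Fin size) ⊎ Fin 0
      color (inC pv) = inj₁ (inj₂ (index pv))
      color (inS pv) = inj₁ (inj₁ (independentColor (Coloring.col C5-independent₃ (position pv))))
      color (inI _)  = inj₁ (inj₁ zero)
      ok : Proper G (color ∘ partView)
      ok u v u≢v same with partView u | partView v
      ... | inC pu | inC pv = contradiction (index-injective pu pv (inj₂-injective (inj₁-injective same))) u≢v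
      ... | inS pu | inS pv = trans (position-adj pu pv)
        (independentColor-proper C5-independent₃ (position-distinct pu pv u≢v) (inj₁-injective (inj₁-injective same)))
      ... | inS pu | inI pv = trans (G-sym u v) (IS v u pv pu)
      ... | inI pu | inS pv = IS u v pu pv
      ... | inI pu | inI pv = II u v pu pv

    C5⊕K-⊑ : ∀ {m} → m ≤ size → C5 ⊕J K m ⊑ G
    C5⊕K-⊑ m≤size = ⊕J-⊑ loopless (inducesC5⇒⊑ {G = G} c5) (K-⊑ m≤size)
      (λ i j → trans (G-sym _ _) (CS _ _ (element-valid _) (f-S i)))
      (λ i j → CS _ _ (element-valid _) (f-S i))

    coloring-or-C5⊕K : ∀ m → Coloring (3 + m) 0 G ⊎ C5 ⊕J K (suc m) ⊑ G
    coloring-or-C5⊕K m with suc m ≤? size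
    ... | yes m<size = inj₂ (C5⊕K-⊑ m<size)
    ... | no  m≮size = inj₁ (coloring-weaken (+-monoʳ-≤ 3 (≤-pred (≰⇒> m≮size))) ≤-refl independent)

-- C5 has no (1,1)-coloring, hence the bound on k + ℓ.
pseudoSplit-mixed : ∀ {n} {G : Graph n} → IsSimple G → PseudoSplit G →
  ∀ {m} k ℓ → suc k + suc ℓ ≡ 3 + m → Coloring (suc k) (suc ℓ) G
pseudoSplit-mixed simple (p , CC , II , inj₁ noS , CS , IS) k ℓ _ =
  coloring-weaken (s≤s z≤n) (s≤s z≤n) (Split.mixed noS)
  where open PseudoSplitColorings simple p CC II CS IS
pseudoSplit-mixed simple (p , CC , II , inj₂ c5 , CS , IS) zero    (suc ℓ) _ =
  coloring-weaken ≤-refl (s≤s (s≤s z≤n)) (WithC5.mixed c5 C5-mixed₁₂)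
  where open PseudoSplitColorings simple p CC II CS IS
pseudoSplit-mixed simple (p , CC , II , inj₂ c5 , CS , IS) (suc k) ℓ       _ =
  coloring-weaken (s≤s (s≤s z≤n)) (s≤s z≤n) (WithC5.mixed c5 C5-mixed₂₁)
  where open PseudoSplitColorings simple p CC II CS IS

pseudoSplit-obstruction₁ : ∀ {n} {G : Graph n} → IsSimple G → PseudoSplit G → Coloring 1 0 G ⊎ K 2 ⊑ G
pseudoSplit-obstruction₁ simple (p , CC , II , inj₁ noS , CS , IS) = coloring-or-clique (Split.perfect noS) 1
  where open PseudoSplitColorings simple p CC II CS IS
pseudoSplit-obstruction₁ {G = G} simple (p , CC , II , inj₂ c5 , CS , IS) =
  inj₂ (⊑-trans K2-⊑-C5 (inducesC5⇒⊑ {G = G} c5))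

pseudoSplit-obstruction₂ : ∀ {n} {G : Graph n} → IsSimple G → PseudoSplit G →
  (Coloring 2 0 G × Coloring 1 1 G) ⊎ K 3 ⊑ G ⊎ C5 ⊑ G
pseudoSplit-obstruction₂ simple (p , CC , II , inj₁ noS , CS , IS) =
  ⊎-map (_, Split.mixed noS) inj₁ (coloring-or-clique (Split.perfect noS) 2)
  where open PseudoSplitColorings simple p CC II CS IS
pseudoSplit-obstruction₂ {G = G} simple (p , CC , II , inj₂ c5 , CS , IS) = inj₂ (inj₂ (inducesC5⇒⊑ {G = G} c5))

pseudoSplit-obstruction≥3 : ∀ {n} {G : Graph n} → IsSimple G → PseudoSplit G → ∀ m →
  Coloring (3 + m) 0 G ⊎ K (4 + m) ⊑ G ⊎ C5 ⊕J K (suc m) ⊑ G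
pseudoSplit-obstruction≥3 simple (p , CC , II , inj₁ noS , CS , IS) m =
  ⊎-map₂ inj₁ (coloring-or-clique (Split.perfect noS) (3 + m))
  where open PseudoSplitColorings simple p CC II CS IS
pseudoSplit-obstruction≥3 simple (p , CC , II , inj₂ c5 , CS , IS) m =
  ⊎-map₂ inj₂ (WithC5.coloring-or-C5⊕K c5 m)
  where open PseudoSplitColorings simple p CC II CS IS

-- The minimal obstructions

K-pseudoSplit : ∀ n → PseudoSplit (K n)
K-pseudoSplit n = (λ _ → pC) , (λ u v u≢v _ _ → K-adj u≢v) , (λ _ _ ()) , inj₁ (λ _ ()) , (λ _ _ _ ()) , (λ _ _ ())

K-inFps : ∀ z → InFps z (K (suc z))
K-inFps z = K-pseudoSplit (suc z) , K-notBicolorable z , K-deleteBicolorable z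

C5-pseudoSplit : PseudoSplit C5
C5-pseudoSplit = (λ _ → pS) , (λ _ _ _ ()) , (λ _ _ ()) ,
  inj₂ (id , (λ _ _ → id) , (λ _ → refl) , (λ v _ → v , refl) , (λ _ _ → refl)) , (λ _ _ ()) , (λ _ _ ())

C5-inFps : InFps 2 C5
C5-inFps = C5-pseudoSplit , C5-notBicolorable , C5-deleteBicolorable

module C5JoinClique (m : ℕ) where

  J : Graph (5 + suc m)
  J = C5 ⊕J K (suc m)

  inl : C5 ⊑ J
  inl = ⊕J-inl C5 (K (suc m))

  inr : K (suc m) ⊑ J
  inr = ⊕J-inr C5 (K (suc m))

  J-simple : IsSimple J
  J-simple = ⊕J-simple C5-simple (K-simple (suc m))

  J-pseudoSplit : PseudoSplit J
  J-pseudoSplit = part ∘ splitAt 5 ,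
    (λ u v u≢v pu pv → trans (adj-⊕J C5 (K (suc m)) u v)
                             (CC (splitAt 5 u) (splitAt 5 v) (u≢v ∘ splitAt-injective 5) pu pv)) ,
    (λ u v pu → contradiction pu (noI (splitAt 5 u))) ,
    inj₂ (embed inl , (λ _ _ → embed-injective inl) , (λ i → cong part (splitAt-↑ˡ 5 i (suc m))) , onto , embed-adj inl) ,
    (λ u v pu pv → trans (adj-⊕J C5 (K (suc m)) u v) (CS (splitAt 5 u) (splitAt 5 v) pu pv)) ,
    (λ u v pu → contradiction pu (noI (splitAt 5 u)))
    where
    part : Fin 5 ⊎ Fin (suc m) → Part
    part = [ const pS , const pC ]′
    CC : ∀ s t → s ≢ t → part s ≡ pC → part t ≡ pC → joinAdj C5 (K (suc m)) s t ≡ true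
    CC (inj₂ a) (inj₂ b) s≢t _ _ = K-adj (s≢t ∘ cong inj₂)
    noI : ∀ s → ¬ part s ≡ pI
    noI (inj₁ _) ()
    noI (inj₂ _) ()
    CS : ∀ s t → part s ≡ pC → part t ≡ pS → joinAdj C5 (K (suc m)) s t ≡ true
    CS (inj₂ _) (inj₁ _) _ _ = refl
    onto : ∀ v → part (splitAt 5 v) ≡ pS → ∃ λ i → i ↑ˡ suc m ≡ v
    onto v pv with splitView 5 v
    ... | left i = i , refl

  J-color-bound : ∀ {k} → Coloring k 0 J → 4 + m ≤ k
  J-color-bound {k} c = bound (C5-rainbow (color ∘ embed inl) separated)
    where
    color : Fin (5 + suc m) → Fin k
    color = independentColor ∘ Coloring.col c
    J-adjacent : ∀ {x y} → adj J x y ≡ true → color x ≢ color y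
    J-adjacent xy = independentColor-adjacent c (adjacent⇒distinct (proj₂ J-simple) xy) xy
    separated : ∀ i j → adj C5 i j ≡ true → color (embed inl i) ≢ color (embed inl j)
    separated i j ij = J-adjacent (trans (embed-adj inl i j) ij)
    bound : Σ (Fin 3 → Fin 5) (λ t → Injective _≡_ _≡_ (color ∘ embed inl ∘ t)) → 4 + m ≤ k
    bound (t , injective) = disjoint-injections⇒≤ injective (clique-rainbow inr c)
      λ i b → J-adjacent (adj-⊕J-join C5 (K (suc m)) (inj₁ (t i)) (inj₂ b))

  J-notBicolorable : ¬ Bicolorable (3 + m) J
  J-notBicolorable bic = 1+n≰n (J-color-bound (bic (3 + m) 0 (+-identityʳ _)))

  J-cliques : Coloring 0 3 J
  J-cliques = proper⇒coloring (proper-⊕J color ok)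
    where
    color : Fin 5 ⊎ Fin (suc m) → Fin 0 ⊎ Fin 3
    color = [ Coloring.col C5-cliques₃ , const (inj₂ zero) ]′
    ok : ∀ s t → s ≢ t → color s ≡ color t → joinAdj C5 (K (suc m)) s t ≡ isCliqueColor (color s)
    ok (inj₁ i) (inj₁ j) s≢t same = coloring⇒proper C5-cliques₃ i j (s≢t ∘ cong inj₁) same
    ok (inj₁ i) (inj₂ b) s≢t same = sym (cong isCliqueColor same)
    ok (inj₂ a) (inj₁ j) s≢t same = refl
    ok (inj₂ a) (inj₂ b) s≢t same = K-adj (s≢t ∘ cong inj₂)

  J-deleteIndependent : ∀ v → Coloring (3 + m) 0 (delete J v)
  J-deleteIndependent v with splitView 5 v
  ... | left i  = coloring-⊑ (delete-⊕J-⊑ˡ C5 (K (suc m)) i)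
                    (⊕J-independentColoring (C5-deleteIndependent₂ i) (discreteColoring (K (suc m))))
  ... | right b = coloring-⊑ (delete-⊕J-⊑ʳ C5 (K (suc m)) b)
                    (⊕J-independentColoring C5-independent₃ (discreteColoring (delete (K (suc m)) b)))

  J-deleteBicolorable : ∀ v → Bicolorable (3 + m) (delete J v)
  J-deleteBicolorable v = bicolorable (J-deleteIndependent v)
    (coloring-⊑ (delete-⊑ J v) (coloring-weaken ≤-refl (s≤s (s≤s (s≤s z≤n))) J-cliques))
    λ k ℓ eq → coloring-⊑ (delete-⊑ J v) (pseudoSplit-mixed J-simple J-pseudoSplit k ℓ eq)

  J-inFps : InFps (3 + m) J
  J-inFps = J-pseudoSplit , J-notBicolorable , J-deleteBicolorable

  U : Graph (5 + suc m)
  U = C5 ⊕U complement (K (suc m))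

  U≅complementJ : U ≅ complement J
  U≅complementJ = ≅-trans {G = complement C5 ⊕U complement (K (suc m))} {H = complement J}
    (⊕U-cong C5-selfComplementary ≅-refl) (complement-⊕J C5 (K (suc m)))

  U-inFps : InFps (3 + m) U
  U-inFps = inFps-≅ {H = complement J} U≅complementJ (complement-inFps J-inFps)

-- The classification

⊑-inFps⇒≅ : ∀ {z m n} {H : Graph m} {G : Graph n} → H ⊑ G → InFps z H →
  AllVertexDeletedBicolorable z G → G ≅ H
⊑-inFps⇒≅ E (_ , ¬bic , _) = ⊑-minimal⇒≅ E ¬bic

module Classification {n} (G : Graph n) (simple : IsSimple G) where

  private
    loopless : ∀ u → adj G u u ≡ false
    loopless = proj₂ simple
    simple′ : IsSimple (complement G)
    simple′ = complement-simple simple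

  complement-⊑-inFps⇒≅ : ∀ {z m} {H : Graph m} → H ⊑ complement G → InFps z (complement H) →
    AllVertexDeletedBicolorable z G → G ≅ complement H
  complement-⊑-inFps⇒≅ E = ⊑-inFps⇒≅ (complement-⊑ loopless E)

  classification₁ : InFps 1 G ⇔ (G ≅ K 2 ⊎ G ≅ complement (K 2))
  classification₁ = mk⇔ forward [ (λ iso → inFps-≅ {H = K 2} iso (K-inFps 1)) ,
                                  (λ iso → inFps-≅ {H = complement (K 2)} iso (complement-inFps (K-inFps 1))) ]′
    where
    forward : InFps 1 G → G ≅ K 2 ⊎ G ≅ complement (K 2)
    forward (ps , ¬bic , del)
      with pseudoSplit-obstruction₁ simple ps | pseudoSplit-obstruction₁ simple′ (complement-pseudoSplit ps)
    ... | inj₂ E | _       = inj₁ (⊑-inFps⇒≅ E (K-inFps 1) del)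
    ... | inj₁ _ | inj₂ E  = inj₂ (complement-⊑-inFps⇒≅ E (complement-inFps (K-inFps 1)) del)
    ... | inj₁ c | inj₁ c′ =
      contradiction (bicolorable c (coloring-fromComplement c′) λ { zero _ () ; (suc _) _ () }) ¬bic

  classification₂ : InFps 2 G ⇔ (G ≅ K 3 ⊎ G ≅ C5 ⊎ G ≅ complement (K 3))
  classification₂ = mk⇔ forward [ (λ iso → inFps-≅ {H = K 3} iso (K-inFps 2)) ,
                                  [ (λ iso → inFps-≅ {H = C5} iso C5-inFps) ,
                                    (λ iso → inFps-≅ {H = complement (K 3)} iso (complement-inFps (K-inFps 2))) ]′ ]′
    where
    forward : InFps 2 G → G ≅ K 3 ⊎ G ≅ C5 ⊎ G ≅ complement (K 3)
    forward (ps , ¬bic , del)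
      with pseudoSplit-obstruction₂ simple ps | pseudoSplit-obstruction₂ simple′ (complement-pseudoSplit ps)
    ... | inj₂ (inj₁ E)  | _              = inj₁ (⊑-inFps⇒≅ E (K-inFps 2) del)
    ... | inj₂ (inj₂ E)  | _              = inj₂ (inj₁ (⊑-inFps⇒≅ E C5-inFps del))
    ... | inj₁ _         | inj₂ (inj₁ E) =
      inj₂ (inj₂ (complement-⊑-inFps⇒≅ E (complement-inFps (K-inFps 2)) del))
    ... | inj₁ _         | inj₂ (inj₂ E) =
      inj₂ (inj₁ (⊑-inFps⇒≅ (⊑-trans C5⊑complementC5 (complement-⊑ loopless E)) C5-inFps del))
      where
      C5⊑complementC5 : C5 ⊑ complement C5
      C5⊑complementC5 = ≅⇒⊑ {G = C5} {complement C5} C5-selfComplementary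
    ... | inj₁ (c , c₁₁) | inj₁ (c′ , _)  =
      contradiction (bicolorable c (coloring-fromComplement c′)
                                 λ { zero _ refl → c₁₁ ; (suc zero) _ () ; (suc (suc _)) _ () }) ¬bic

  classification≥3 : ∀ m → InFps (3 + m) G ⇔
    (G ≅ K (4 + m) ⊎ G ≅ C5 ⊕J K (suc m) ⊎ G ≅ complement (K (4 + m)) ⊎ G ≅ C5 ⊕U complement (K (suc m)))
  classification≥3 m = mk⇔ forward
    [ (λ iso → inFps-≅ {H = K (4 + m)} iso (K-inFps (3 + m))) ,
    [ (λ iso → inFps-≅ {H = J} iso J-inFps) ,
    [ (λ iso → inFps-≅ {H = complement (K (4 + m))} iso (complement-inFps (K-inFps (3 + m)))) ,
      (λ iso → inFps-≅ {H = U} iso U-inFps) ]′ ]′ ]′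
    where
    open C5JoinClique m
    forward : InFps (3 + m) G → G ≅ K (4 + m) ⊎ G ≅ J ⊎ G ≅ complement (K (4 + m)) ⊎ G ≅ U
    forward (ps , ¬bic , del)
      with pseudoSplit-obstruction≥3 simple ps m | pseudoSplit-obstruction≥3 simple′ (complement-pseudoSplit ps) m
    ... | inj₂ (inj₁ E) | _              = inj₁ (⊑-inFps⇒≅ E (K-inFps (3 + m)) del)
    ... | inj₂ (inj₂ E) | _              = inj₂ (inj₁ (⊑-inFps⇒≅ E J-inFps del))
    ... | inj₁ _        | inj₂ (inj₁ E) =
      inj₂ (inj₂ (inj₁ (complement-⊑-inFps⇒≅ E (complement-inFps (K-inFps (3 + m))) del)))
    ... | inj₁ _        | inj₂ (inj₂ E) =
      inj₂ (inj₂ (inj₂ (⊑-inFps⇒≅ (⊑-trans U⊑complementJ (complement-⊑ loopless E)) U-inFps del)))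
      where
      U⊑complementJ : U ⊑ complement J
      U⊑complementJ = ≅⇒⊑ {G = U} {complement J} U≅complementJ
    ... | inj₁ c        | inj₁ c′        =
      contradiction (bicolorable c (coloring-fromComplement c′) (pseudoSplit-mixed simple ps)) ¬bic

mainTheorem10 :
    (∀ {n} (G : Graph n) → IsSimple G →
      (InFps 1 G ⇔ (G ≅ K 2 ⊎ G ≅ complement (K 2))))
    ×
    (∀ {n} (G : Graph n) → IsSimple G →
      (InFps 2 G ⇔ (G ≅ K 3 ⊎ G ≅ C5 ⊎ G ≅ complement (K 3))))
    ×
    (∀ (z : ℕ) → 3 ≤ z → ∀ {n} (G : Graph n) → IsSimple G →
      (InFps z G ⇔ (G ≅ K (suc z) ⊎ G ≅ C5 ⊕J K (z ∸ 2)
                    ⊎ G ≅ complement (K (suc z)) ⊎ G ≅ C5 ⊕U complement (K (z ∸ 2)))))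
mainTheorem10 =
  Classification.classification₁ ,
  Classification.classification₂ ,
  λ { (suc (suc (suc m))) (s≤s (s≤s (s≤s _))) G simple → Classification.classification≥3 G simple m }
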